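{- For any two integer indices $\mathbf{k},\mathbf{k}'\in\mathcal{I}$, one has $m_{\mathbf{k}\ast\mathbf{k}'}=\min\{m_{\mathbf{k}},\,m_{\mathbf{k}'},\,m_{\mathbf{k}}+m_{\mathbf{k}'}\}$ (with $\infty+a=\infty$).
   Context: An integer index is a tuple $\mathbf{k}=(k_1,\dots,k_r)\in\mathbb{Z}^r$, $r\ge0$ ($\emptyset$ for $r=0$); $\mathcal{I}=\bigsqcup_{r\ge0}\mathbb{Z}^r$ and $\mathrm{span}_{\mathbb{Q}}\{\mathcal{I}\}$ is the formal $\mathbb{Q}$-vector space with basis $\mathcal{I}$. For $r\ge1$, $m_{\mathbf{k}}=\min_{1\le t\le r}\sum_{i=t}^r(k_i-1)$, and $m_\emptyset=\infty$. For $\Sigma\in\mathrm{span}_{\mathbb{Q}}\{\mathcal{I}\}$, $\mathrm{Supp}(\Sigma)$ is the set of indices occurring in $\Sigma$ with nonzero coefficient and $m_\Sigma=\min\{m_{\mathbf{k}}:\mathbf{k}\in\mathrm{Supp}(\Sigma)\}$. The stuffle product $\ast$ is the bilinear product on $\mathrm{span}_{\mathbb{Q}}\{\mathcal{I}\}$ defined recursively by $\emptyset\ast\mathbf{k}=\mathbf{k}\ast\emptyset=\mathbf{k}$ and, for $\mathbf{k},\mathbf{k}'\in\mathcal{I}$, $k,k'\in\mathbb{Z}$, $(\mathbf{k},k)\ast(\mathbf{k}',k')=(\mathbf{k}\ast(\mathbf{k}',k'),k)+((\mathbf{k},k)\ast\mathbf{k}',k')+(\mathbf{k}\ast\mathbf{k}',k+k')$,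 where $(\mathbf{k},k)$ denotes concatenation and $(\Sigma,a)$ for $\Sigma\in\mathrm{span}_{\mathbb{Q}}\{\mathcal{I}\}$ means appending $a$ to every index, extended linearly. -}

module Defs where

open import Data.Integer using (ℤ; _+_; _-_; 1ℤ; +_) renaming (_⊓_ to _⊓ℤ_)
import Data.Integer as ℤ
open import Data.Rational using (ℚ; 0ℚ; 1ℚ) renaming (_+_ to _+ℚ_)
import Data.Rational as ℚ
open import Data.List using (List; []; _∷_; _++_; map; reverse; foldr)
open import Data.List.Properties using (≡-dec)
open import Data.Product using (_×_; _,_)
open import Relation.Nullary using (Dec; yes; no)
open import Relation.Binary.PropositionalEquality using (_≡_)

-- Integer indices (k₁,…,k_r) as lists in natural order; [] is ∅.
Index : Set
Index = List ℤ

_≟I_ : (k l : Index) → Dec (k ≡ l)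
_≟I_ = ≡-dec ℤ._≟_

-- Elements of span_ℚ{I}: formal finite linear combinations,
-- represented by a list of (coefficient, index) terms (summed).
Span : Set
Span = List (ℚ × Index)

⟦_⟧ : Index → Span
⟦ k ⟧ = (1ℚ , k) ∷ []

coeff : Span → Index → ℚ
coeff [] k = 0ℚ
coeff ((q , l) ∷ Σ) k with l ≟I k
... | yes _ = q +ℚ coeff Σ k
... | no  _ = coeff Σ k

data ℤ∞ : Set where
  fin : ℤ → ℤ∞
  ∞   : ℤ∞

_⊓∞_ : ℤ∞ → ℤ∞ → ℤ∞
fin a ⊓∞ fin b = fin (a ⊓ℤ b)
fin a ⊓∞ ∞ = fin a
∞ ⊓∞ y = y

_+∞_ : ℤ∞ → ℤ∞ → ℤ∞
fin a +∞ fin b = fin (a + b)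
fin a +∞ ∞ = ∞
∞ +∞ y = ∞

weightSum : Index → ℤ
weightSum = foldr (λ x s → (x - 1ℤ) + s) (+ 0)

-- m_k = min_{1≤t≤r} Σ_{i=t}^r (k_i - 1), m_∅ = ∞
mIdx : Index → ℤ∞
mIdx [] = ∞
mIdx (x ∷ xs) = fin (weightSum (x ∷ xs)) ⊓∞ mIdx xs

-- m_Σ = min { m_k : k ∈ Supp(Σ) }, Supp(Σ) = indices with nonzero coefficient
-- (min of the empty set is ∞)
mSpanAux : Span → Span → ℤ∞
mSpanAux Σ [] = ∞
mSpanAux Σ ((_ , k) ∷ rest) with coeff Σ k ℚ.≟ 0ℚ
... | yes _ = mSpanAux Σ rest
... | no  _ = mIdx k ⊓∞ mSpanAux Σ rest

mSpan : Span → ℤ∞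
mSpan Σ = mSpanAux Σ Σ

appendAll : Span → ℤ → Span
appendAll Σ a = map (λ { (q , k) → (q , k ++ (a ∷ [])) }) Σ

-- stuffle on reversed indices (head of the list = last entry)
private
  consAll : ℤ → Span → Span
  consAll a = map (λ { (q , k) → (q , a ∷ k) })

  stuffleRev : Index → Index → Span
  stuffleRev [] l = ⟦ l ⟧
  stuffleRev (a ∷ k) [] = ⟦ a ∷ k ⟧
  stuffleRev (a ∷ k) (b ∷ l) =
    consAll a (stuffleRev k (b ∷ l)) ++
    consAll b (stuffleRev (a ∷ k) l) ++
    consAll (a + b) (stuffleRev k l)

  revAll : Span → Span
  revAll = map (λ { (q , k) → (q , reverse k) })

-- Stuffle product of two indices:
-- ∅ ∗ k = k ∗ ∅ = k,
-- (k,a) ∗ (l,b) = (k ∗ (l,b), a) + ((k,a) ∗ l, b) + (k ∗ l, a+b)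
_∗_ : Index → Index → Span
k ∗ l = revAll (stuffleRev (reverse k) (reverse l))

-- Read from the right, m satisfies m(k,c) = (c - 1) + min(0, m_k), and
-- min(0, min(x, y, x + y)) = min(0, x) + min(0, y). Feeding both into the recursion
-- (k,a) ∗ (l,b) = (k ∗ (l,b), a) + ((k,a) ∗ l, b) + (k ∗ l, a + b) and writing
-- X = m(k,a), Y = m(l,b), the three terms contribute min(X, X + Y), min(Y, X + Y) and
-- X + Y + 1, whose minimum is min(X, Y, X + Y). All coefficients of k ∗ l are positive,
-- so nothing cancels and the support of k ∗ l is every index it lists.
module Submission where

open import Defs
open import Relation.Binary.PropositionalEquality
  using (_≡_; _≢_; refl; sym; trans; cong; cong₂; subst; module ≡-Reasoning)

open import Data.Integer using (ℤ; _+_; _-_; _⊓_; _≤_; 0ℤ; 1ℤ)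
import Data.Integer.Properties as ℤ
open import Data.Integer.Solver using (module +-*-Solver)
open import Data.List using (List; []; _∷_; _++_; _∷ʳ_; map; reverse)
open import Data.List.Membership.Propositional using (_∈_)
open import Data.List.Properties using (map-++; reverse-++; reverse-involutive; unfold-reverse)
open import Data.List.Relation.Unary.All as All using (All; []; _∷_)
open import Data.List.Relation.Unary.All.Properties using (++⁺; map⁺)
open import Data.List.Relation.Unary.Any using (here; there)
open import Data.List.Reverse using (Reverse; []; _∶_∶ʳ_; reverseView)
open import Data.Product using (_,_; proj₁; proj₂)
open import Data.Rational using (0ℚ; Positive; NonNegative)
import Data.Rational.Properties as ℚ
open import Function using (_∘_)
open import Relation.Nullary using (yes; no; contradiction)

import Algebra.Properties.CommutativeSemigroup ℤ.⊓-commutativeSemigroup as ⊓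
import Algebra.Properties.CommutativeSemigroup ℤ.+-commutativeSemigroup as +

open ≡-Reasoning

+-distribˡ-⊓ : ∀ c i j → c + (i ⊓ j) ≡ (c + i) ⊓ (c + j)
+-distribˡ-⊓ c = ℤ.mono-≤-distrib-⊓ (ℤ.+-monoʳ-≤ c)

+-distribʳ-⊓ : ∀ c i j → (i ⊓ j) + c ≡ (i + c) ⊓ (j + c)
+-distribʳ-⊓ c = ℤ.mono-≤-distrib-⊓ (ℤ.+-monoˡ-≤ c)

⊓∞-identityʳ : ∀ x → x ⊓∞ ∞ ≡ x
⊓∞-identityʳ (fin a) = refl
⊓∞-identityʳ ∞ = refl

⊓∞-assoc : ∀ x y z → (x ⊓∞ y) ⊓∞ z ≡ x ⊓∞ (y ⊓∞ z)
⊓∞-assoc (fin a) (fin b) (fin c) = cong fin (ℤ.⊓-assoc a b c)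
⊓∞-assoc (fin a) (fin b) ∞ = refl
⊓∞-assoc (fin a) ∞ z = refl
⊓∞-assoc ∞ y z = refl

minPlus : ℤ∞ → ℤ∞ → ℤ∞
minPlus x y = (x ⊓∞ y) ⊓∞ (x +∞ y)

minPlus-identityʳ : ∀ x → minPlus x ∞ ≡ x
minPlus-identityʳ (fin a) = refl
minPlus-identityʳ ∞ = refl

min0 : ℤ∞ → ℤ
min0 (fin a) = 0ℤ ⊓ a
min0 ∞ = 0ℤ

min0≤0 : ∀ x → min0 x ≤ 0ℤ
min0≤0 (fin a) = ℤ.i⊓j≤i 0ℤ a
min0≤0 ∞ = ℤ.≤-refl

min0-⊓∞ : ∀ x y → min0 (x ⊓∞ y) ≡ min0 x ⊓ min0 y
min0-⊓∞ (fin a) (fin b) = ℤ.mono-≤-distrib-⊓ (ℤ.⊓-monoʳ-≤ 0ℤ) a b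
min0-⊓∞ (fin a) ∞ = sym (ℤ.i≤j⇒i⊓j≡i (ℤ.i⊓j≤i 0ℤ a))
min0-⊓∞ ∞ y = sym (ℤ.i≥j⇒i⊓j≡j (min0≤0 y))

min0-fin-⊓∞ : ∀ w x → min0 (fin w ⊓∞ x) ≡ w ⊓ min0 x
min0-fin-⊓∞ w (fin a) = ⊓.x∙yz≈y∙xz 0ℤ w a
min0-fin-⊓∞ w ∞ = ℤ.⊓-comm 0ℤ w

min0-minPlus : ∀ x y → min0 (minPlus x y) ≡ min0 x + min0 y
min0-minPlus ∞ ∞ = refl
min0-minPlus ∞ (fin b) = sym (ℤ.+-identityˡ (0ℤ ⊓ b))
min0-minPlus (fin a) ∞ = sym (ℤ.+-identityʳ (0ℤ ⊓ a))
min0-minPlus (fin a) (fin b) = begin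
  0ℤ ⊓ ((a ⊓ b) ⊓ (a + b))               ≡⟨ cong (0ℤ ⊓_) (ℤ.⊓-assoc a b (a + b)) ⟩
  0ℤ ⊓ (a ⊓ (b ⊓ (a + b)))               ≡⟨ sym (ℤ.⊓-assoc 0ℤ a _) ⟩
  (0ℤ ⊓ a) ⊓ (b ⊓ (a + b))
    ≡⟨ cong₂ (λ u w → u ⊓ (w ⊓ (a + b))) (sym (ℤ.+-identityʳ _)) (sym (ℤ.+-identityˡ b)) ⟩
  ((0ℤ ⊓ a) + 0ℤ) ⊓ ((0ℤ + b) ⊓ (a + b))
    ≡⟨ cong (((0ℤ ⊓ a) + 0ℤ) ⊓_) (sym (+-distribʳ-⊓ b 0ℤ a)) ⟩
  ((0ℤ ⊓ a) + 0ℤ) ⊓ ((0ℤ ⊓ a) + b)       ≡⟨ sym (+-distribˡ-⊓ (0ℤ ⊓ a) 0ℤ b) ⟩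
  (0ℤ ⊓ a) + (0ℤ ⊓ b)                    ∎

extend : ℤ → ℤ∞ → ℤ∞
extend c x = fin ((c - 1ℤ) + min0 x)

extend-⊓∞ : ∀ c x y → extend c (x ⊓∞ y) ≡ extend c x ⊓∞ extend c y
extend-⊓∞ c x y = cong fin (trans (cong ((c - 1ℤ) +_) (min0-⊓∞ x y)) (+-distribˡ-⊓ (c - 1ℤ) _ _))

stuffleStep : ℤ → ℤ → ℤ∞ → ℤ∞ → ℤ∞ → ℤ∞
stuffleStep a b x y z = extend a x ⊓∞ (extend b y ⊓∞ extend (a + b) z)

minPlus-stuffleStep : ∀ a b x y →
  stuffleStep a b (minPlus x (extend b y)) (minPlus (extend a x) y) (minPlus x y)
    ≡ minPlus (extend a x) (extend b y)
minPlus-stuffleStep a b x y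
  rewrite min0-minPlus x (extend b y) | min0-minPlus (extend a x) y | min0-minPlus x y
  = cong fin (begin
      (A + (u + (0ℤ ⊓ Y))) ⊓ ((B + ((0ℤ ⊓ X) + v)) ⊓ (((a + b) - 1ℤ) + (u + v)))
        ≡⟨ cong₂ _⊓_ term₁ (cong₂ _⊓_ term₂ term₃) ⟩
      (X ⊓ S) ⊓ ((Y ⊓ S) ⊓ (1ℤ + S))
        ≡⟨ cong ((X ⊓ S) ⊓_) (trans (ℤ.⊓-assoc Y S _) (cong (Y ⊓_) S⊓1+S≡S)) ⟩
      (X ⊓ S) ⊓ (Y ⊓ S)
        ≡⟨ ⊓.interchange X S Y S ⟩
      (X ⊓ Y) ⊓ (S ⊓ S)
        ≡⟨ cong ((X ⊓ Y) ⊓_) (ℤ.⊓-idem S) ⟩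
      (X ⊓ Y) ⊓ S ∎)
  where
  A = a - 1ℤ
  B = b - 1ℤ
  u = min0 x
  v = min0 y
  X = A + u
  Y = B + v
  S = X + Y
  term₁ : A + (u + (0ℤ ⊓ Y)) ≡ X ⊓ S
  term₁ = trans (sym (ℤ.+-assoc A u _)) (trans (+-distribˡ-⊓ X 0ℤ Y) (cong (_⊓ S) (ℤ.+-identityʳ X)))
  term₂ : B + ((0ℤ ⊓ X) + v) ≡ Y ⊓ S
  term₂ = trans (+.x∙yz≈y∙xz B (0ℤ ⊓ X) v)
                (trans (+-distribʳ-⊓ Y 0ℤ X) (cong (_⊓ S) (ℤ.+-identityˡ Y)))
  S⊓1+S≡S : S ⊓ (1ℤ + S) ≡ S
  S⊓1+S≡S = ℤ.i≤j⇒i⊓j≡i (ℤ.i≤j+i S 1ℤ)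
  term₃ : ((a + b) - 1ℤ) + (u + v) ≡ 1ℤ + S
  term₃ = solve 4 (λ a b u v → ((a :+ b) :- con 1ℤ) :+ (u :+ v)
                              := con 1ℤ :+ (((a :- con 1ℤ) :+ u) :+ ((b :- con 1ℤ) :+ v))) refl a b u v
    where open +-*-Solver

reverse-∷ʳ : ∀ {a} {A : Set a} (xs : List A) x → reverse (xs ∷ʳ x) ≡ x ∷ reverse xs
reverse-∷ʳ xs x = reverse-++ xs (x ∷ [])

∷ʳ-induction₂ : ∀ {a ℓ} {A : Set a} (P : List A → List A → Set ℓ) →
  (∀ l → P [] l) →
  (∀ k x → P (k ∷ʳ x) []) →
  (∀ k x l y → P k (l ∷ʳ y) → P (k ∷ʳ x) l → P k l → P (k ∷ʳ x) (l ∷ʳ y)) →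
  ∀ k l → P k l
∷ʳ-induction₂ P left right step k l = go (reverseView k) (reverseView l)
  where
  go : ∀ {k l} → Reverse k → Reverse l → P k l
  go [] _ = left _
  go (k ∶ _ ∶ʳ x) [] = right k x
  go (k ∶ rk ∶ʳ x) (l ∶ rl ∶ʳ y) =
    step k x l y (go rk (l ∶ rl ∶ʳ y)) (go (k ∶ rk ∶ʳ x) rl) (go rk rl)

weightSum-∷ʳ : ∀ k c → weightSum (k ∷ʳ c) ≡ (c - 1ℤ) + weightSum k
weightSum-∷ʳ [] c = refl
weightSum-∷ʳ (x ∷ k) c =
  trans (cong ((x - 1ℤ) +_) (weightSum-∷ʳ k c)) (+.x∙yz≈y∙xz (x - 1ℤ) (c - 1ℤ) (weightSum k))

mIdx-∷ʳ : ∀ k c → mIdx (k ∷ʳ c) ≡ extend c (mIdx k)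
mIdx-∷ʳ [] c = refl
mIdx-∷ʳ (x ∷ k) c = begin
  fin (weightSum (x ∷ k ∷ʳ c)) ⊓∞ mIdx (k ∷ʳ c)
    ≡⟨ cong₂ (λ w m → fin w ⊓∞ m) (weightSum-∷ʳ (x ∷ k) c) (mIdx-∷ʳ k c) ⟩
  fin (((c - 1ℤ) + weightSum (x ∷ k)) ⊓ ((c - 1ℤ) + min0 (mIdx k)))
    ≡⟨ cong fin (sym (+-distribˡ-⊓ (c - 1ℤ) _ _)) ⟩
  fin ((c - 1ℤ) + (weightSum (x ∷ k) ⊓ min0 (mIdx k)))
    ≡⟨ cong (λ w → fin ((c - 1ℤ) + w)) (sym (min0-fin-⊓∞ (weightSum (x ∷ k)) (mIdx k))) ⟩
  extend c (mIdx (x ∷ k)) ∎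

-- Unlike mSpan, this ignores the coefficients: every listed index counts.
mListed : Span → ℤ∞
mListed [] = ∞
mListed ((_ , k) ∷ Σ) = mIdx k ⊓∞ mListed Σ

mListed-++ : ∀ Σ Σ′ → mListed (Σ ++ Σ′) ≡ mListed Σ ⊓∞ mListed Σ′
mListed-++ [] Σ′ = refl
mListed-++ ((_ , k) ∷ Σ) Σ′ =
  trans (cong (mIdx k ⊓∞_) (mListed-++ Σ Σ′)) (sym (⊓∞-assoc (mIdx k) (mListed Σ) (mListed Σ′)))

mListed-appendAll : ∀ c {Σ} → Σ ≢ [] → mListed (appendAll Σ c) ≡ extend c (mListed Σ)
mListed-appendAll c {[]} Σ≢[] = contradiction refl Σ≢[]
mListed-appendAll c {(_ , k) ∷ []} _ = begin
  mIdx (k ∷ʳ c) ⊓∞ ∞       ≡⟨ ⊓∞-identityʳ _ ⟩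
  mIdx (k ∷ʳ c)            ≡⟨ mIdx-∷ʳ k c ⟩
  extend c (mIdx k)        ≡⟨ cong (extend c) (sym (⊓∞-identityʳ (mIdx k))) ⟩
  extend c (mIdx k ⊓∞ ∞)   ∎
mListed-appendAll c {(_ , k) ∷ s ∷ Σ} _ = begin
  mIdx (k ∷ʳ c) ⊓∞ mListed (appendAll (s ∷ Σ) c)
    ≡⟨ cong₂ _⊓∞_ (mIdx-∷ʳ k c) (mListed-appendAll c {s ∷ Σ} (λ ())) ⟩
  extend c (mIdx k) ⊓∞ extend c (mListed (s ∷ Σ))
    ≡⟨ sym (extend-⊓∞ c (mIdx k) _) ⟩
  extend c (mIdx k ⊓∞ mListed (s ∷ Σ)) ∎

reverseAll : Span → Span
reverseAll = map (λ s → proj₁ s , reverse (proj₂ s))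

consAll : ℤ → Span → Span
consAll a = map (λ s → proj₁ s , a ∷ proj₂ s)

reverseAll-involutive : ∀ Σ → reverseAll (reverseAll Σ) ≡ Σ
reverseAll-involutive [] = refl
reverseAll-involutive ((q , k) ∷ Σ) =
  cong₂ _∷_ (cong (q ,_) (reverse-involutive k)) (reverseAll-involutive Σ)

reverseAll-injective : ∀ {Σ Σ′} → reverseAll Σ ≡ reverseAll Σ′ → Σ ≡ Σ′
reverseAll-injective {Σ} {Σ′} eq = begin
  Σ                          ≡⟨ sym (reverseAll-involutive Σ) ⟩
  reverseAll (reverseAll Σ)  ≡⟨ cong reverseAll eq ⟩
  reverseAll (reverseAll Σ′) ≡⟨ reverseAll-involutive Σ′ ⟩
  Σ′                         ∎

reverseAll-consAll : ∀ a Σ → reverseAll (consAll a Σ) ≡ appendAll (reverseAll Σ) a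
reverseAll-consAll a [] = refl
reverseAll-consAll a ((q , k) ∷ Σ) =
  cong₂ _∷_ (cong (q ,_) (unfold-reverse a k)) (reverseAll-consAll a Σ)

-- Defs builds _∗_ from a private stuffle on reversed indices; this is a copy of it
-- that can be named, and ∗-reverse identifies the two.
stuffleʳ : Index → Index → Span
stuffleʳ [] l = ⟦ l ⟧
stuffleʳ (a ∷ k) [] = ⟦ a ∷ k ⟧
stuffleʳ (a ∷ k) (b ∷ l) =
  consAll a (stuffleʳ k (b ∷ l)) ++ consAll b (stuffleʳ (a ∷ k) l) ++ consAll (a + b) (stuffleʳ k l)

-- Abstracting reverse (reverse p) and reverse (reverse q) exposes the private
-- stuffle applied to p and q, both in the goal and in the induction hypotheses.
∗-reverse : ∀ p q → reverse p ∗ reverse q ≡ reverseAll (stuffleʳ p q)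
∗-reverse [] q rewrite reverse-involutive q = refl
∗-reverse (a ∷ p) [] rewrite reverse-involutive (a ∷ p) = refl
∗-reverse (a ∷ p) (b ∷ q)
  with reverse (reverse (a ∷ p)) | reverse-involutive (a ∷ p) | reverse (reverse p) | reverse-involutive p
     | reverse (reverse (b ∷ q)) | reverse-involutive (b ∷ q) | reverse (reverse q) | reverse-involutive q
     | ∗-reverse p (b ∷ q) | ∗-reverse (a ∷ p) q | ∗-reverse p q
... | _ | refl | _ | refl | _ | refl | _ | refl | ih₁ | ih₂ | ih₃ =
  cong reverseAll (cong₂ _++_ (cong (consAll a) (reverseAll-injective ih₁))
                   (cong₂ _++_ (cong (consAll b) (reverseAll-injective ih₂))
                               (cong (consAll (a + b)) (reverseAll-injective ih₃))))

∗-stuffleʳ : ∀ k l {p q} → reverse k ≡ p → reverse l ≡ q → k ∗ l ≡ reverseAll (stuffleʳ p q)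
∗-stuffleʳ k l refl refl =
  trans (sym (cong₂ _∗_ (reverse-involutive k) (reverse-involutive l))) (∗-reverse (reverse k) (reverse l))

∗-identityˡ : ∀ l → [] ∗ l ≡ ⟦ l ⟧
∗-identityˡ l = cong (λ l′ → (_ , l′) ∷ []) (reverse-involutive l)

∗-∷ʳ-identityʳ : ∀ k a → (k ∷ʳ a) ∗ [] ≡ ⟦ k ∷ʳ a ⟧
∗-∷ʳ-identityʳ k a = begin
  (k ∷ʳ a) ∗ []                ≡⟨ ∗-stuffleʳ (k ∷ʳ a) [] (reverse-∷ʳ k a) refl ⟩
  ⟦ reverse (a ∷ reverse k) ⟧  ≡⟨ cong ⟦_⟧ (unfold-reverse a (reverse k)) ⟩
  ⟦ reverse (reverse k) ∷ʳ a ⟧ ≡⟨ cong (λ k′ → ⟦ k′ ∷ʳ a ⟧) (reverse-involutive k) ⟩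
  ⟦ k ∷ʳ a ⟧                   ∎

∗-∷ʳ : ∀ k a l b → (k ∷ʳ a) ∗ (l ∷ʳ b) ≡
  appendAll (k ∗ (l ∷ʳ b)) a ++ appendAll ((k ∷ʳ a) ∗ l) b ++ appendAll (k ∗ l) (a + b)
∗-∷ʳ k a l b = begin
  (k ∷ʳ a) ∗ (l ∷ʳ b)
    ≡⟨ ∗-stuffleʳ (k ∷ʳ a) (l ∷ʳ b) (reverse-∷ʳ k a) (reverse-∷ʳ l b) ⟩
  reverseAll (consAll a X ++ consAll b Y ++ consAll (a + b) Z)
    ≡⟨ map-++ _ (consAll a X) _ ⟩
  reverseAll (consAll a X) ++ reverseAll (consAll b Y ++ consAll (a + b) Z)
    ≡⟨ cong (reverseAll (consAll a X) ++_) (map-++ _ (consAll b Y) _) ⟩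
  reverseAll (consAll a X) ++ reverseAll (consAll b Y) ++ reverseAll (consAll (a + b) Z)
    ≡⟨ cong₂ _++_ (reverseAll-consAll a X)
                   (cong₂ _++_ (reverseAll-consAll b Y) (reverseAll-consAll (a + b) Z)) ⟩
  appendAll (reverseAll X) a ++ appendAll (reverseAll Y) b ++ appendAll (reverseAll Z) (a + b)
    ≡⟨ sym (cong₂ _++_ (cong (λ Σ → appendAll Σ a) (∗-stuffleʳ k (l ∷ʳ b) refl (reverse-∷ʳ l b)))
             (cong₂ _++_ (cong (λ Σ → appendAll Σ b) (∗-stuffleʳ (k ∷ʳ a) l (reverse-∷ʳ k a) refl))
                         (cong (λ Σ → appendAll Σ (a + b)) (∗-stuffleʳ k l refl refl)))) ⟩
  appendAll (k ∗ (l ∷ʳ b)) a ++ appendAll ((k ∷ʳ a) ∗ l) b ++ appendAll (k ∗ l) (a + b) ∎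
  where
  X = stuffleʳ (reverse k) (b ∷ reverse l)
  Y = stuffleʳ (a ∷ reverse k) (reverse l)
  Z = stuffleʳ (reverse k) (reverse l)

∗-nonempty : ∀ k l → k ∗ l ≢ []
∗-nonempty = ∷ʳ-induction₂ P left right step
  where
  P : Index → Index → Set
  P k l = k ∗ l ≢ []
  left : ∀ l → P [] l
  left l rewrite ∗-identityˡ l = λ ()
  right : ∀ k a → P (k ∷ʳ a) []
  right k a rewrite ∗-∷ʳ-identityʳ k a = λ ()
  step : ∀ k a l b → P k (l ∷ʳ b) → P (k ∷ʳ a) l → P k l → P (k ∷ʳ a) (l ∷ʳ b)
  step k a l b ne _ _ rewrite ∗-∷ʳ k a l b with k ∗ (l ∷ʳ b) | ne
  ... | [] | ne′ = contradiction refl ne′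
  ... | _ ∷ _ | _ = λ ()

∗-positive : ∀ k l → All (Positive ∘ proj₁) (k ∗ l)
∗-positive = ∷ʳ-induction₂ P left right step
  where
  P : Index → Index → Set
  P k l = All (Positive ∘ proj₁) (k ∗ l)
  left : ∀ l → P [] l
  left l rewrite ∗-identityˡ l = _ ∷ []
  right : ∀ k a → P (k ∷ʳ a) []
  right k a rewrite ∗-∷ʳ-identityʳ k a = _ ∷ []
  step : ∀ k a l b → P k (l ∷ʳ b) → P (k ∷ʳ a) l → P k l → P (k ∷ʳ a) (l ∷ʳ b)
  step k a l b p₁ p₂ p₃ rewrite ∗-∷ʳ k a l b = ++⁺ (map⁺ p₁) (++⁺ (map⁺ p₂) (map⁺ p₃))

coeff-nonNegative : ∀ {Σ} → All (Positive ∘ proj₁) Σ → ∀ k → NonNegative (coeff Σ k)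
coeff-nonNegative [] k = _
coeff-nonNegative {(q , l) ∷ Σ} (q>0 ∷ ps) k with l ≟I k
... | yes _ = ℚ.nonNeg+nonNeg⇒nonNeg q {{ℚ.pos⇒nonNeg q {{q>0}}}} (coeff Σ k) {{coeff-nonNegative ps k}}
... | no _ = coeff-nonNegative ps k

coeff-positive : ∀ {Σ s} → All (Positive ∘ proj₁) Σ → s ∈ Σ → Positive (coeff Σ (proj₂ s))
coeff-positive {(q , l) ∷ Σ} {s} (q>0 ∷ ps) s∈Σ with l ≟I proj₂ s
coeff-positive {(q , l) ∷ Σ} {s} (q>0 ∷ ps) s∈Σ | yes _ =
  ℚ.pos+nonNeg⇒pos q {{q>0}} (coeff Σ (proj₂ s)) {{coeff-nonNegative ps (proj₂ s)}}
coeff-positive (_ ∷ _) (here refl) | no l≢l = contradiction refl l≢l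
coeff-positive (_ ∷ ps) (there s∈Σ) | no _ = coeff-positive ps s∈Σ

mSpanAux-positive : ∀ Σ {R} → All (Positive ∘ coeff Σ ∘ proj₂) R → mSpanAux Σ R ≡ mListed R
mSpanAux-positive Σ [] = refl
mSpanAux-positive Σ {s ∷ R} (pos ∷ ps) with coeff Σ (proj₂ s) ℚ.≟ 0ℚ
... | yes c≡0 = contradiction (ℚ.positive⁻¹ 0ℚ {{subst Positive c≡0 pos}}) (ℚ.<-irrefl refl)
... | no _ = cong (mIdx (proj₂ s) ⊓∞_) (mSpanAux-positive Σ ps)

mSpan-positive : ∀ {Σ} → All (Positive ∘ proj₁) Σ → mSpan Σ ≡ mListed Σ
mSpan-positive {Σ} ps = mSpanAux-positive Σ (All.tabulate (coeff-positive ps))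

mListed-∗-∷ʳ : ∀ k a l b → mListed ((k ∷ʳ a) ∗ (l ∷ʳ b)) ≡
  stuffleStep a b (mListed (k ∗ (l ∷ʳ b))) (mListed ((k ∷ʳ a) ∗ l)) (mListed (k ∗ l))
mListed-∗-∷ʳ k a l b = begin
  mListed ((k ∷ʳ a) ∗ (l ∷ʳ b))
    ≡⟨ cong mListed (∗-∷ʳ k a l b) ⟩
  mListed (A ++ B ++ C)
    ≡⟨ trans (mListed-++ A (B ++ C)) (cong (mListed A ⊓∞_) (mListed-++ B C)) ⟩
  mListed A ⊓∞ (mListed B ⊓∞ mListed C)
    ≡⟨ cong₂ _⊓∞_ (mListed-appendAll a (∗-nonempty k (l ∷ʳ b)))
                   (cong₂ _⊓∞_ (mListed-appendAll b (∗-nonempty (k ∷ʳ a) l))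
                                (mListed-appendAll (a + b) (∗-nonempty k l))) ⟩
  stuffleStep a b (mListed (k ∗ (l ∷ʳ b))) (mListed ((k ∷ʳ a) ∗ l)) (mListed (k ∗ l)) ∎
  where
  A = appendAll (k ∗ (l ∷ʳ b)) a
  B = appendAll ((k ∷ʳ a) ∗ l) b
  C = appendAll (k ∗ l) (a + b)

mListed-∗ : ∀ k l → mListed (k ∗ l) ≡ minPlus (mIdx k) (mIdx l)
mListed-∗ = ∷ʳ-induction₂ P left right step
  where
  P : Index → Index → Set
  P k l = mListed (k ∗ l) ≡ minPlus (mIdx k) (mIdx l)
  left : ∀ l → P [] l
  left l = cong mListed (∗-identityˡ l)
  right : ∀ k a → P (k ∷ʳ a) []
  right k a = begin
    mListed ((k ∷ʳ a) ∗ [])       ≡⟨ cong mListed (∗-∷ʳ-identityʳ k a) ⟩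
    mIdx (k ∷ʳ a) ⊓∞ ∞            ≡⟨ ⊓∞-identityʳ _ ⟩
    mIdx (k ∷ʳ a)                 ≡⟨ sym (minPlus-identityʳ _) ⟩
    minPlus (mIdx (k ∷ʳ a)) ∞     ∎
  step : ∀ k a l b → P k (l ∷ʳ b) → P (k ∷ʳ a) l → P k l → P (k ∷ʳ a) (l ∷ʳ b)
  step k a l b ih₁ ih₂ ih₃ = begin
    mListed ((k ∷ʳ a) ∗ (l ∷ʳ b))
      ≡⟨ mListed-∗-∷ʳ k a l b ⟩
    stuffleStep a b (mListed (k ∗ (l ∷ʳ b))) (mListed ((k ∷ʳ a) ∗ l)) (mListed (k ∗ l))
      ≡⟨ cong₂ (λ m₁ m₂ → stuffleStep a b m₁ m₂ (mListed (k ∗ l))) ih₁ ih₂ ⟩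
    stuffleStep a b (minPlus x (mIdx (l ∷ʳ b))) (minPlus (mIdx (k ∷ʳ a)) y) (mListed (k ∗ l))
      ≡⟨ cong₂ (λ y′ x′ → stuffleStep a b (minPlus x y′) (minPlus x′ y) (mListed (k ∗ l)))
               (mIdx-∷ʳ l b) (mIdx-∷ʳ k a) ⟩
    stuffleStep a b (minPlus x (extend b y)) (minPlus (extend a x) y) (mListed (k ∗ l))
      ≡⟨ cong (stuffleStep a b (minPlus x (extend b y)) (minPlus (extend a x) y)) ih₃ ⟩
    stuffleStep a b (minPlus x (extend b y)) (minPlus (extend a x) y) (minPlus x y)
      ≡⟨ minPlus-stuffleStep a b x y ⟩
    minPlus (extend a x) (extend b y)
      ≡⟨ sym (cong₂ minPlus (mIdx-∷ʳ k a) (mIdx-∷ʳ l b)) ⟩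
    minPlus (mIdx (k ∷ʳ a)) (mIdx (l ∷ʳ b)) ∎
    where
    x = mIdx k
    y = mIdx l

proposition5p3 : ∀ (k k′ : Index) →
    mSpan (k ∗ k′) ≡ (mIdx k ⊓∞ mIdx k′) ⊓∞ (mIdx k +∞ mIdx k′)
proposition5p3 k k′ = begin
  mSpan (k ∗ k′)              ≡⟨ mSpan-positive (∗-positive k k′) ⟩
  mListed (k ∗ k′)            ≡⟨ mListed-∗ k k′ ⟩
  minPlus (mIdx k) (mIdx k′)  ∎
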